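{- Let $M$ be a matroid, $X\subseteq E(M)$, and let $I$ be a basis for $X$ in $M$. Then $\lambda_M(X)=r_{M^*/(X-I)}(I)$, i.e. $\lambda_M(X)$ equals the relative rank of $X$ with respect to $X-I$ in $M^*$.
   Context: Matroids are possibly infinite (in the sense of Bruhn, Diestel, Kriesell, Pendavingh and Wollan); ranks take values in $\mathbb{N}\cup\{\infty\}$. The relative rank of $Y$ with respect to $X$ in $M$ is $r_{M/X}(Y-X)$. The connectivity of $X\subseteq E(M)$ is $\lambda_M(X)=r^*(M|(B\cup B'))$ (the rank of the dual of the restriction to $B\cup B'$), where $B$ is a basis for $X$ and $B'$ is a basis for $E(M)-X$; this value does not depend on the choice of $B$ and $B'$. -}

module Defs where

open import Data.Bool using (Bool; true; false; _∧_; _∨_; not; if_then_else_)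
open import Data.Empty using (⊥)
open import Data.Fin using (Fin)
open import Data.Nat using (ℕ)
open import Data.Sum using (_⊎_)
open import Data.Product using (Σ; ∃; _×_; _,_)
open import Function.Bundles using (_↔_)
open import Relation.Binary.PropositionalEquality using (_≡_)
open import Relation.Nullary using (¬_; Dec)

-- Subsets of a type E, given by characteristic functions
-- (classically every subset has one).

Subset : Set → Set
Subset E = E → Bool

module _ {E : Set} where

  infix 4 _∈_ _⊆_
  _∈_ : E → Subset E → Set
  x ∈ A = A x ≡ true

  _⊆_ : Subset E → Subset E → Set
  A ⊆ B = ∀ x → x ∈ A → x ∈ B

  ∅ : Subset E
  ∅ _ = false

  infixl 6 _∪_ _∩_ _─_
  _∪_ : Subset E → Subset E → Subset E
  (A ∪ B) x = A x ∨ B x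

  _∩_ : Subset E → Subset E → Subset E
  (A ∩ B) x = A x ∧ B x

  _─_ : Subset E → Subset E → Subset E
  (A ─ B) x = A x ∧ not (B x)

  Elements : Subset E → Set
  Elements A = Σ E (λ x → x ∈ A)

  HasSize : Subset E → ℕ → Set
  HasSize A n = Elements A ↔ Fin n

  -- Two subsets have the same cardinality in ℕ ∪ {∞}:
  -- for every n, one has n elements iff the other does
  -- (so either both are finite of equal size, or both are infinite).
  SameSizeℕ∞ : Subset E → Subset E → Set
  SameSizeℕ∞ A B = ∀ n → (HasSize A n → HasSize B n) × (HasSize B n → HasSize A n)

record SetSystem (E : Set) : Set₁ where
  field
    ground : Subset E
    Indep  : Subset E → Set
open SetSystem public

module _ {E : Set} where

  IsMaximal : (Subset E → Set) → Subset E → Set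
  IsMaximal P I = P I × (∀ J → P J → I ⊆ J → J ⊆ I)

  IsBase : SetSystem E → Subset E → Set
  IsBase N B = IsMaximal (Indep N) B

  IsBasisOf : SetSystem E → Subset E → Subset E → Set
  IsBasisOf N X B = IsMaximal (λ J → Indep N J × J ⊆ X) B

-- Matroids in the sense of Bruhn–Diestel–Kriesell–Pendavingh–Wollan
-- (independence axioms (I1), (I2), (I3), (IM)).

module _ {E : Set} where

  -- I + x, i.e. I ∪ {x}.  Since E need not have decidable equality,
  -- we quantify over subsets J with y ∈ J ⇔ (y ∈ I or y ≡ x).
  IsAdd : Subset E → E → Subset E → Set
  IsAdd I x J = ∀ y → (y ∈ J → (y ∈ I ⊎ y ≡ x)) × ((y ∈ I ⊎ y ≡ x) → y ∈ J)

record IsMatroid {E : Set} (N : SetSystem E) : Set where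
  field
    indep⊆ground : ∀ I → Indep N I → I ⊆ ground N
    I1 : Indep N ∅
    I2 : ∀ I J → Indep N J → I ⊆ J → Indep N I
    I3 : ∀ I B → Indep N I → ¬ IsBase N I → IsBase N B →
         ∃ λ x → x ∈ B × ¬ (x ∈ I) × ∃ λ J → IsAdd I x J × Indep N J
    IM : ∀ I X → Indep N I → I ⊆ X → X ⊆ ground N →
         ∃ λ J → IsMaximal (λ K → Indep N K × I ⊆ K × K ⊆ X) J

record Matroid (E : Set) : Set₁ where
  field
    system    : SetSystem E
    isMatroid : IsMatroid system
open Matroid public

module _ {E : Set} where

  dual : SetSystem E → SetSystem E
  dual N = record
    { ground = ground N
    ; Indep  = λ J → J ⊆ ground N × ∃ λ B → IsBase N B × B ⊆ (ground N ─ J)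
    }

  restrict : SetSystem E → Subset E → SetSystem E
  restrict N S = record
    { ground = ground N ∩ S
    ; Indep  = λ J → Indep N J × J ⊆ S
    }

  delete : SetSystem E → Subset E → SetSystem E
  delete N Z = restrict N (ground N ─ Z)

  contract : SetSystem E → Subset E → SetSystem E
  contract N Z = dual (delete (dual N) Z)

  -- "r_N(Y) = |K|": K is a basis of Y in N; ranks live in ℕ ∪ {∞},
  -- compared via SameSizeℕ∞.

{-# OPTIONS --safe #-}
module Submission where

-- Both sides are nullities |T ─ C| of a set T with basis C, compared in ℕ ∪ {∞}.
-- A base of (M|(B ∪ B'))* is the complement in B ∪ B' of a basis of B ∪ B', so λ_M(X) is the
-- nullity of B ∪ B'.  A basis K of I in M*/(X − I) is I − D for a basis D of E − (X − I) = I ∪ (E − X)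
-- leaving as much of I uncovered as possible; this extremality forces B'' = D − X to be a basis of
-- E − X, and then r_{M*/(X−I)}(I) is the nullity of B'' ∪ I.  The nullity of P ∪ W does not depend
-- on the basis P of a set Y disjoint from W: if C ⊇ P₁ is a basis of P₁ ∪ W, then P₂ ∪ (C − Y) is a
-- basis of P₂ ∪ W with the same complement W − C.  Swapping B for I (bases of X) and then B' for B''
-- (bases of E − X) connects the two sides.  Two bases of the same set have equinumerous complements
-- by exchanging one element at a time, by induction on the finite size of one complement.

open import Defs
open import Axiom.ExcludedMiddle using (ExcludedMiddle)
open import Axiom.DoubleNegationElimination using (em⇒dne)
open import Axiom.UniquenessOfIdentityProofs using (module Decidable⇒UIP)
open import Level using (0ℓ)
open import Data.Bool using (true; false)
open import Data.Bool.Properties using (∨-assoc; ∨-comm) renaming (_≟_ to _≟ᵇ_)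
open import Data.Empty using (⊥-elim)
open import Data.Unit using (⊤; tt)
open import Data.Nat using (ℕ; zero; suc)
open import Data.Fin using (Fin; punchIn; punchOut)
open import Data.Fin.Properties using (1↔⊤; +↔⊎; punchInᵢ≢i; punchOut-cong; punchOut-punchIn; punchIn-punchOut)
open import Data.Sum using (_⊎_; inj₁; inj₂; [_,_]′)
open import Data.Sum.Algebra using (⊎-cong)
open import Data.Sum.Properties using (inj₂-injective)
open import Data.Product using (Σ-syntax; ∃-syntax; _×_; _,_; proj₁; proj₂)
open import Function.Base using (_∘_)
open import Function.Bundles using (_↔_; Inverse; mk↔ₛ′)
open import Function.Properties.Inverse using (↔-sym; ↔-trans)
open import Relation.Binary.Definitions using (DecidableEquality)
open import Relation.Binary.PropositionalEquality using (_≡_; _≢_; refl; sym; trans; cong; subst)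
open import Relation.Nullary using (¬_; Dec; yes; no)
open import Relation.Nullary.Decidable using (isYes)

private
  variable
    E : Set
    A B C C₀ C₁ C₂ D I J K P P₁ P₂ Q T T′ T″ U W X Y Z : Subset E
    f w x y z : E
    n : ℕ

infix 4 _∉_ _≐_

_∉_ : E → Subset E → Set
x ∉ A = ¬ x ∈ A

_≐_ : Subset E → Subset E → Set
A ≐ B = A ⊆ B × B ⊆ A

Disjoint : Subset E → Subset E → Set
Disjoint A B = ∀ x → x ∈ A → x ∉ B

∈? : (A : Subset E) (x : E) → Dec (x ∈ A)
∈? A x = A x ≟ᵇ true

∈-irrelevant : (p q : x ∈ A) → p ≡ q
∈-irrelevant = Decidable⇒UIP.≡-irrelevant _≟ᵇ_

∪⁻ : (A B : Subset E) → x ∈ A ∪ B → x ∈ A ⊎ x ∈ B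
∪⁻ {x = x} A B p with A x
... | true  = inj₁ refl
... | false = inj₂ p

∪⁺ˡ : (A B : Subset E) → x ∈ A → x ∈ A ∪ B
∪⁺ˡ A B p rewrite p = refl

∪⁺ʳ : (A B : Subset E) → x ∈ B → x ∈ A ∪ B
∪⁺ʳ {x = x} A B p with A x
... | true  = refl
... | false = p

∩⁻ : (A B : Subset E) → x ∈ A ∩ B → x ∈ A × x ∈ B
∩⁻ {x = x} A B p with A x | B x
... | true | true = refl , refl

∩⁺ : (A B : Subset E) → x ∈ A → x ∈ B → x ∈ A ∩ B
∩⁺ A B p q rewrite p | q = refl

─⁻ : (A B : Subset E) → x ∈ A ─ B → x ∈ A × x ∉ B
─⁻ {x = x} A B p with A x | B x
... | true | false = refl , λ ()

─⁺ : (A B : Subset E) → x ∈ A → x ∉ B → x ∈ A ─ B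
─⁺ {x = x} A B p q rewrite p with B x
... | true  = ⊥-elim (q refl)
... | false = refl

⊆-refl : A ⊆ A
⊆-refl x x∈A = x∈A

⊆-trans : A ⊆ B → B ⊆ C → A ⊆ C
⊆-trans A⊆B B⊆C x x∈A = B⊆C x (A⊆B x x∈A)

≐-sym : A ≐ B → B ≐ A
≐-sym (A⊆B , B⊆A) = B⊆A , A⊆B

≐-trans : A ≐ B → B ≐ C → A ≐ C
≐-trans (A⊆B , B⊆A) (B⊆C , C⊆B) = ⊆-trans A⊆B B⊆C , ⊆-trans C⊆B B⊆A

≗⇒≐ : (∀ x → A x ≡ B x) → A ≐ B
≗⇒≐ A≗B = (λ x x∈A → trans (sym (A≗B x)) x∈A) , (λ x x∈B → trans (A≗B x) x∈B)

⊆-∪ˡ : (A B : Subset E) → A ⊆ A ∪ B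
⊆-∪ˡ A B x = ∪⁺ˡ A B

⊆-∪ʳ : (A B : Subset E) → B ⊆ A ∪ B
⊆-∪ʳ A B x = ∪⁺ʳ A B

∪-⊆ : A ⊆ C → B ⊆ C → A ∪ B ⊆ C
∪-⊆ {A = A} {B = B} A⊆C B⊆C x p with ∪⁻ A B p
... | inj₁ x∈A = A⊆C x x∈A
... | inj₂ x∈B = B⊆C x x∈B

∪-monoˡ : (C : Subset E) → A ⊆ B → A ∪ C ⊆ B ∪ C
∪-monoˡ {B = B} C A⊆B = ∪-⊆ (⊆-trans A⊆B (⊆-∪ˡ B C)) (⊆-∪ʳ B C)

∪-monoʳ : (A : Subset E) → B ⊆ C → A ∪ B ⊆ A ∪ C
∪-monoʳ {C = C} A B⊆C = ∪-⊆ (⊆-∪ˡ A C) (⊆-trans B⊆C (⊆-∪ʳ A C))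

∩-⊆ˡ : (A B : Subset E) → A ∩ B ⊆ A
∩-⊆ˡ A B x p = proj₁ (∩⁻ A B p)

∩-⊆ʳ : (A B : Subset E) → A ∩ B ⊆ B
∩-⊆ʳ A B x p = proj₂ (∩⁻ A B p)

─-⊆ : (A B : Subset E) → A ─ B ⊆ A
─-⊆ A B x p = proj₁ (─⁻ A B p)

─-monoˡ : (C : Subset E) → A ⊆ B → A ─ C ⊆ B ─ C
─-monoˡ {A = A} {B = B} C A⊆B x p = let (x∈A , x∉C) = ─⁻ A C p in ─⁺ B C (A⊆B x x∈A) x∉C

─-antimonoʳ : (A : Subset E) → B ⊆ C → A ─ C ⊆ A ─ B
─-antimonoʳ {B = B} {C = C} A B⊆C x p = let (x∈A , x∉C) = ─⁻ A C p in ─⁺ A B x∈A (x∉C ∘ B⊆C x)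

⊆-─-∪ : (A B : Subset E) → A ⊆ (A ─ B) ∪ B
⊆-─-∪ A B x x∈A with ∈? B x
... | yes x∈B = ∪⁺ʳ (A ─ B) B x∈B
... | no x∉B  = ∪⁺ˡ (A ─ B) B (─⁺ A B x∈A x∉B)

∪-assoc : (A B C : Subset E) → A ∪ (B ∪ C) ≐ (A ∪ B) ∪ C
∪-assoc A B C = ≗⇒≐ λ x → sym (∨-assoc (A x) (B x) (C x))

∪-comm : (A B : Subset E) → A ∪ B ≐ B ∪ A
∪-comm A B = ≗⇒≐ λ x → ∨-comm (A x) (B x)

─-comm : (A B C : Subset E) → (A ─ B) ─ C ⊆ (A ─ C) ─ B
─-comm A B C x p =
  let (x∈A─B , x∉C) = ─⁻ (A ─ B) C p ; (x∈A , x∉B) = ─⁻ A B x∈A─B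
  in ─⁺ (A ─ C) B (─⁺ A C x∈A x∉C) x∉B

─-─ : (A B C : Subset E) → C ⊆ B → B ⊆ A → A ─ (B ─ C) ≐ C ∪ (A ─ B)
─-─ A B C C⊆B B⊆A = lhs⊆rhs , rhs⊆lhs
  where
  lhs⊆rhs : A ─ (B ─ C) ⊆ C ∪ (A ─ B)
  lhs⊆rhs x p with ─⁻ A (B ─ C) p | ∈? B x
  ... | x∈A , x∉B─C | no x∉B = ∪⁺ʳ C (A ─ B) (─⁺ A B x∈A x∉B)
  ... | x∈A , x∉B─C | yes x∈B with ∈? C x
  ...   | yes x∈C = ∪⁺ˡ C (A ─ B) x∈C
  ...   | no x∉C = ⊥-elim (x∉B─C (─⁺ B C x∈B x∉C))
  rhs⊆lhs : C ∪ (A ─ B) ⊆ A ─ (B ─ C)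
  rhs⊆lhs x p with ∪⁻ C (A ─ B) p
  ... | inj₁ x∈C = ─⁺ A (B ─ C) (B⊆A x (C⊆B x x∈C)) λ x∈B─C → proj₂ (─⁻ B C x∈B─C) x∈C
  ... | inj₂ x∈A─B = let (x∈A , x∉B) = ─⁻ A B x∈A─B in ─⁺ A (B ─ C) x∈A λ x∈B─C → x∉B (─-⊆ B C x x∈B─C)

swap-─ : Disjoint W Y → P₁ ⊆ C → P₂ ⊆ Y → (P₁ ∪ W) ─ C ≐ (P₂ ∪ W) ─ (P₂ ∪ (C ─ Y))
swap-─ {W = W} {Y = Y} {P₁ = P₁} {C = C} {P₂ = P₂} W∩Y=∅ P₁⊆C P₂⊆Y = lhs⊆rhs , rhs⊆lhs
  where
  lhs⊆rhs : (P₁ ∪ W) ─ C ⊆ (P₂ ∪ W) ─ (P₂ ∪ (C ─ Y))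
  lhs⊆rhs x p with ─⁻ (P₁ ∪ W) C p
  ... | x∈P₁∪W , x∉C = ─⁺ (P₂ ∪ W) (P₂ ∪ (C ─ Y)) (∪⁺ʳ P₂ W x∈W)
                         ([ (λ x∈P₂ → W∩Y=∅ x x∈W (P₂⊆Y x x∈P₂)) , (λ x∈C─Y → x∉C (─-⊆ C Y x x∈C─Y)) ]′ ∘ ∪⁻ P₂ (C ─ Y))
    where
    x∈W : x ∈ W
    x∈W = [ (λ x∈P₁ → ⊥-elim (x∉C (P₁⊆C x x∈P₁))) , (λ x∈W → x∈W) ]′ (∪⁻ P₁ W x∈P₁∪W)
  rhs⊆lhs : (P₂ ∪ W) ─ (P₂ ∪ (C ─ Y)) ⊆ (P₁ ∪ W) ─ C
  rhs⊆lhs x p with ─⁻ (P₂ ∪ W) (P₂ ∪ (C ─ Y)) p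
  ... | x∈P₂∪W , x∉P₂∪C─Y =
    ─⁺ (P₁ ∪ W) C (∪⁺ʳ P₁ W x∈W) λ x∈C → x∉P₂∪C─Y (∪⁺ʳ P₂ (C ─ Y) (─⁺ C Y x∈C (W∩Y=∅ x x∈W)))
    where
    x∈W : x ∈ W
    x∈W = [ (λ x∈P₂ → ⊥-elim (x∉P₂∪C─Y (∪⁺ˡ P₂ (C ─ Y) x∈P₂))) , (λ x∈W → x∈W) ]′ (∪⁻ P₂ W x∈P₂∪W)

Elements-≐ : A ≐ B → Elements A ↔ Elements B
Elements-≐ {A = A} {B = B} (A⊆B , B⊆A) =
  mk↔ₛ′ (λ (x , p) → x , A⊆B x p) (λ (x , p) → x , B⊆A x p)
        (λ (x , p) → cong (x ,_) (∈-irrelevant {A = B} _ _)) (λ (x , p) → cong (x ,_) (∈-irrelevant {A = A} _ _))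

hasSize-≐ : A ≐ B → HasSize A n → HasSize B n
hasSize-≐ (A⊆B , B⊆A) = ↔-trans (Elements-≐ (B⊆A , A⊆B))

sameSize-≐ : A ≐ B → SameSizeℕ∞ A B
sameSize-≐ (A⊆B , B⊆A) n = hasSize-≐ (A⊆B , B⊆A) , hasSize-≐ (B⊆A , A⊆B)

sameSize-sym : SameSizeℕ∞ A B → SameSizeℕ∞ B A
sameSize-sym A~B n = proj₂ (A~B n) , proj₁ (A~B n)

sameSize-trans : SameSizeℕ∞ A B → SameSizeℕ∞ B C → SameSizeℕ∞ A C
sameSize-trans A~B B~C n = (λ a → proj₁ (B~C n) (proj₁ (A~B n) a)) , (λ c → proj₂ (A~B n) (proj₂ (B~C n) c))

hasSize-zero⇒∉ : HasSize A 0 → x ∉ A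
hasSize-zero⇒∉ φ x∈A with Inverse.to φ (_ , x∈A)
... | ()

⊤⊎-↔-Fin-suc : {Y : Set} {n : ℕ} → Y ↔ Fin n → (⊤ ⊎ Y) ↔ Fin (suc n)
⊤⊎-↔-Fin-suc φ = ↔-trans (⊎-cong (↔-sym 1↔⊤) φ) (↔-sym +↔⊎)

⊤⊎-↔-Fin-suc⁻ : {Y : Set} {n : ℕ} → (⊤ ⊎ Y) ↔ Fin (suc n) → Y ↔ Fin n
⊤⊎-↔-Fin-suc⁻ {Y} {n} φ = mk↔ₛ′ to′ from′ to′∘from′ from′∘to′
  where
  open Inverse φ
  i : Fin (suc n)
  i = to (inj₁ tt)
  i≢to-inj₂ : ∀ y → i ≢ to (inj₂ y)
  i≢to-inj₂ y eq with trans (sym (strictlyInverseʳ (inj₁ tt))) (trans (cong from eq) (strictlyInverseʳ (inj₂ y)))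
  ... | ()
  to′ : Y → Fin n
  to′ y = punchOut (i≢to-inj₂ y)
  preimage : ∀ k → Σ[ y ∈ Y ] from (punchIn i k) ≡ inj₂ y
  preimage k with from (punchIn i k) in eq
  ... | inj₁ tt = ⊥-elim (punchInᵢ≢i i k (trans (sym (strictlyInverseˡ (punchIn i k))) (cong to eq)))
  ... | inj₂ y  = y , refl
  from′ : Fin n → Y
  from′ k = proj₁ (preimage k)
  to′∘from′ : ∀ k → to′ (from′ k) ≡ k
  to′∘from′ k =
    trans (punchOut-cong i (trans (cong to (sym (proj₂ (preimage k)))) (strictlyInverseˡ (punchIn i k))))
          (punchOut-punchIn i)
  from′∘to′ : ∀ y → from′ (to′ y) ≡ y
  from′∘to′ y = inj₂-injective (trans (sym (proj₂ (preimage (to′ y))))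
                  (trans (cong from (punchIn-punchOut (i≢to-inj₂ y))) (strictlyInverseʳ (inj₂ y))))

module Singleton {E : Set} (_≟_ : DecidableEquality E) where

  ｛_｝ : E → Subset E
  ｛ y ｝ x = isYes (x ≟ y)

  ∈｛｝⁻ : x ∈ ｛ y ｝ → x ≡ y
  ∈｛｝⁻ {x = x} {y = y} p with x ≟ y
  ... | yes x≡y = x≡y

  ∈｛｝⁺ : x ≡ y → x ∈ ｛ y ｝
  ∈｛｝⁺ {x = x} {y = y} x≡y with x ≟ y
  ... | yes _   = refl
  ... | no x≢y = ⊥-elim (x≢y x≡y)

  x∈A∪｛x｝ : (A : Subset E) → x ∈ A ∪ ｛ x ｝
  x∈A∪｛x｝ {x = x} A = ∪⁺ʳ A ｛ x ｝ (∈｛｝⁺ refl)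

  ∪｛｝-⊆ : A ⊆ B → x ∈ B → A ∪ ｛ x ｝ ⊆ B
  ∪｛｝-⊆ {B = B} {x = x} A⊆B x∈B = ∪-⊆ A⊆B λ y y∈｛x｝ → subst (_∈ B) (sym (∈｛｝⁻ {y = x} y∈｛x｝)) x∈B

  ─-exchange-≐ : (U C : Subset E) → z ∈ C → (U ─ ｛ z ｝) ─ ((C ─ ｛ z ｝) ∪ ｛ f ｝) ≐ (U ─ C) ─ ｛ f ｝
  ─-exchange-≐ {z = z} {f = f} U C z∈C = lhs⊆rhs , rhs⊆lhs
    where
    lhs⊆rhs : (U ─ ｛ z ｝) ─ ((C ─ ｛ z ｝) ∪ ｛ f ｝) ⊆ (U ─ C) ─ ｛ f ｝
    lhs⊆rhs x p =
      let (x∈U−z , x∉C′) = ─⁻ (U ─ ｛ z ｝) ((C ─ ｛ z ｝) ∪ ｛ f ｝) p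
          (x∈U , x∉｛z｝) = ─⁻ U ｛ z ｝ x∈U−z
      in ─⁺ (U ─ C) ｛ f ｝ (─⁺ U C x∈U λ x∈C → x∉C′ (∪⁺ˡ (C ─ ｛ z ｝) ｛ f ｝ (─⁺ C ｛ z ｝ x∈C x∉｛z｝)))
                           (λ x∈｛f｝ → x∉C′ (∪⁺ʳ (C ─ ｛ z ｝) ｛ f ｝ x∈｛f｝))
    rhs⊆lhs : (U ─ C) ─ ｛ f ｝ ⊆ (U ─ ｛ z ｝) ─ ((C ─ ｛ z ｝) ∪ ｛ f ｝)
    rhs⊆lhs x p with ─⁻ (U ─ C) ｛ f ｝ p
    ... | x∈U─C , x∉｛f｝ with ─⁻ U C x∈U─C
    ... | x∈U , x∉C = ─⁺ (U ─ ｛ z ｝) ((C ─ ｛ z ｝) ∪ ｛ f ｝)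
                          (─⁺ U ｛ z ｝ x∈U λ x∈｛z｝ → x∉C (subst (_∈ C) (sym (∈｛｝⁻ x∈｛z｝)) z∈C))
                          λ x∈C′ → [ (λ x∈C−z → x∉C (─-⊆ C ｛ z ｝ x x∈C−z)) , x∉｛f｝ ]′ (∪⁻ (C ─ ｛ z ｝) ｛ f ｝ x∈C′)

  ─-exchange-⊆ˡ : f ∈ C₂ → C₁ ─ C₂ ⊆ U → ((C₁ ─ ｛ z ｝) ∪ ｛ f ｝) ─ C₂ ⊆ U ─ ｛ z ｝
  ─-exchange-⊆ˡ {f = f} {C₂ = C₂} {C₁ = C₁} {U = U} {z = z} f∈C₂ C₁─C₂⊆U x p with ─⁻ ((C₁ ─ ｛ z ｝) ∪ ｛ f ｝) C₂ p
  ... | x∈C₁′ , x∉C₂ with ∪⁻ (C₁ ─ ｛ z ｝) ｛ f ｝ x∈C₁′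
  ...   | inj₂ x∈｛f｝ = ⊥-elim (x∉C₂ (subst (_∈ C₂) (sym (∈｛｝⁻ x∈｛f｝)) f∈C₂))
  ...   | inj₁ x∈C₁−z = let (x∈C₁ , x∉｛z｝) = ─⁻ C₁ ｛ z ｝ x∈C₁−z
                        in ─⁺ U ｛ z ｝ (C₁─C₂⊆U x (─⁺ C₁ C₂ x∈C₁ x∉C₂)) x∉｛z｝

  ─-exchange-⊆ʳ : z ∉ C₂ → C₂ ─ C₁ ⊆ U → C₂ ─ ((C₁ ─ ｛ z ｝) ∪ ｛ f ｝) ⊆ U ─ ｛ z ｝
  ─-exchange-⊆ʳ {z = z} {C₂ = C₂} {C₁ = C₁} {U = U} {f = f} z∉C₂ C₂─C₁⊆U x p =
    let (x∈C₂ , x∉C₁′) = ─⁻ C₂ ((C₁ ─ ｛ z ｝) ∪ ｛ f ｝) p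
        x∉｛z｝ : x ∉ ｛ z ｝
        x∉｛z｝ x∈｛z｝ = z∉C₂ (subst (_∈ C₂) (∈｛｝⁻ x∈｛z｝) x∈C₂)
        x∉C₁ : x ∉ C₁
        x∉C₁ x∈C₁ = x∉C₁′ (∪⁺ˡ (C₁ ─ ｛ z ｝) ｛ f ｝ (─⁺ C₁ ｛ z ｝ x∈C₁ x∉｛z｝))
    in ─⁺ U ｛ z ｝ (C₂─C₁⊆U x (─⁺ C₂ C₁ x∈C₂ x∉C₁)) x∉｛z｝

  Elements-split : z ∈ A → Elements A ↔ (⊤ ⊎ Elements (A ─ ｛ z ｝))
  Elements-split {z = z} {A = A} z∈A = mk↔ₛ′ to from to∘from from∘to
    where
    classify : ∀ x → x ∈ A → Dec (x ≡ z) → ⊤ ⊎ Elements (A ─ ｛ z ｝)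
    classify x x∈A (yes _)   = inj₁ tt
    classify x x∈A (no x≢z) = inj₂ (x , ─⁺ A ｛ z ｝ x∈A (x≢z ∘ ∈｛｝⁻))
    to : Elements A → ⊤ ⊎ Elements (A ─ ｛ z ｝)
    to (x , x∈A) = classify x x∈A (x ≟ z)
    from : ⊤ ⊎ Elements (A ─ ｛ z ｝) → Elements A
    from (inj₁ tt)      = z , z∈A
    from (inj₂ (x , p)) = x , proj₁ (─⁻ A ｛ z ｝ p)
    to∘from : ∀ s → to (from s) ≡ s
    to∘from (inj₁ tt) = classify-z (z ≟ z)
      where
      classify-z : ∀ d → classify z z∈A d ≡ inj₁ tt
      classify-z (yes _)   = refl
      classify-z (no z≢z) = ⊥-elim (z≢z refl)
    to∘from (inj₂ (x , p)) = classify-x (x ≟ z)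
      where
      classify-x : ∀ d → classify x (proj₁ (─⁻ A ｛ z ｝ p)) d ≡ inj₂ (x , p)
      classify-x (yes x≡z) = ⊥-elim (proj₂ (─⁻ A ｛ z ｝ p) (∈｛｝⁺ x≡z))
      classify-x (no _)    = cong (λ q → inj₂ (x , q)) (∈-irrelevant {A = A ─ ｛ z ｝} _ _)
    from∘to : ∀ e → from (to e) ≡ e
    from∘to (x , x∈A) with x ≟ z
    ... | yes refl = cong (z ,_) (∈-irrelevant {A = A} _ _)
    ... | no _     = cong (x ,_) (∈-irrelevant {A = A} _ _)

  hasSize-remove : z ∈ A → HasSize A (suc n) → HasSize (A ─ ｛ z ｝) n
  hasSize-remove z∈A φ = ⊤⊎-↔-Fin-suc⁻ (↔-trans (↔-sym (Elements-split z∈A)) φ)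

  hasSize-insert : z ∈ A → HasSize (A ─ ｛ z ｝) n → HasSize A (suc n)
  hasSize-insert z∈A φ = ↔-trans (Elements-split z∈A) (⊤⊎-↔-Fin-suc φ)

isMaximal-⇔ : {P Q : Subset E → Set} → (∀ J → P J → Q J) → (∀ J → Q J → P J) →
              IsMaximal P A → IsMaximal Q A
isMaximal-⇔ P⇒Q Q⇒P (PA , maxA) = P⇒Q _ PA , λ J QJ A⊆J → maxA J (Q⇒P J QJ) A⊆J

restrict-indep⊆ground : {N : SetSystem E} → (∀ A → Indep N A → A ⊆ ground N) →
                        ∀ A → Indep (restrict N T) A → A ⊆ ground (restrict N T)
restrict-indep⊆ground {T = T} {N = N} indep⊆ground A (indA , A⊆T) x x∈A =
  ∩⁺ (ground N) T (indep⊆ground A indA x x∈A) (A⊆T x x∈A)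

module DualBases (N : SetSystem E) (indep⊆ground : ∀ A → Indep N A → A ⊆ ground N) where

  indep-dual-─ : A ⊆ ground N → IsBase N D → Indep (dual N) (A ─ D)
  indep-dual-─ {A = A} {D = D} A⊆G baseD =
    ⊆-trans (─-⊆ A D) A⊆G , D , baseD ,
    λ x x∈D → ─⁺ (ground N) (A ─ D) (indep⊆ground D (proj₁ baseD) x x∈D) (λ p → proj₂ (─⁻ A D p) x∈D)

  -- The last component is the maximality of K: no base of N leaves more of A uncovered than D.
  isBasisOf-dual⇒complement : A ⊆ ground N → IsBasisOf (dual N) A K →
    Σ[ D ∈ Subset E ] IsBase N D × K ≐ A ─ D × (∀ D′ → IsBase N D′ → A ─ D ⊆ A ─ D′ → A ─ D′ ⊆ A ─ D)
  isBasisOf-dual⇒complement {A = A} {K = K} A⊆G (((_ , D , baseD , D⊆G─K) , K⊆A) , maxK) =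
    D , baseD , (K⊆A─D , A─D⊆K) , λ D′ baseD′ A─D⊆A─D′ →
      ⊆-trans (maxK (A ─ D′) (indep-dual-─ A⊆G baseD′ , ─-⊆ A D′) (⊆-trans K⊆A─D A─D⊆A─D′)) K⊆A─D
    where
    K⊆A─D : K ⊆ A ─ D
    K⊆A─D x x∈K = ─⁺ A D (K⊆A x x∈K) λ x∈D → proj₂ (─⁻ (ground N) K (D⊆G─K x x∈D)) x∈K
    A─D⊆K : A ─ D ⊆ K
    A─D⊆K = maxK (A ─ D) (indep-dual-─ A⊆G baseD , ─-⊆ A D) K⊆A─D

  complement-isBase-dual : IsBase N B → IsBase (dual N) (ground N ─ B)
  complement-isBase-dual {B = B} baseB = indep-dual-─ ⊆-refl baseB , maximal
    where
    maximal : ∀ J → Indep (dual N) J → ground N ─ B ⊆ J → J ⊆ ground N ─ B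
    maximal J (J⊆G , B′ , baseB′ , B′⊆G─J) G─B⊆J x x∈J =
      ─⁺ (ground N) B (J⊆G x x∈J) λ x∈B → proj₂ (─⁻ (ground N) J (B′⊆G─J x (B⊆B′ x x∈B))) x∈J
      where
      B′⊆B : B′ ⊆ B
      B′⊆B y y∈B′ with ∈? B y
      ... | yes y∈B = y∈B
      ... | no y∉B = ⊥-elim (proj₂ (─⁻ (ground N) J (B′⊆G─J y y∈B′))
                       (G─B⊆J y (─⁺ (ground N) B (indep⊆ground B′ (proj₁ baseB′) y y∈B′) y∉B)))
      B⊆B′ : B ⊆ B′
      B⊆B′ = proj₂ baseB′ B (proj₁ baseB) B′⊆B

  isBase-dual⇒complement : IsBase (dual N) K → Σ[ D ∈ Subset E ] IsBase N D × K ≐ ground N ─ D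
  isBase-dual⇒complement baseK =
    let (D , baseD , K≐G─D , _) =
          isBasisOf-dual⇒complement ⊆-refl (isMaximal-⇔ (λ J indJ → indJ , proj₁ indJ) (λ J → proj₁) baseK)
    in D , baseD , K≐G─D

module MatroidTheory (em : ExcludedMiddle 0ℓ) {E : Set} (M : Matroid E) where

  open IsMatroid (isMatroid M)
  open Singleton (λ (x y : E) → em)

  N : SetSystem E
  N = system M

  G : Subset E
  G = ground N

  Ind : Subset E → Set
  Ind = Indep N

  IsBasis : Subset E → Subset E → Set
  IsBasis = IsBasisOf N

  dne : {P : Set} → ¬ ¬ P → P
  dne = em⇒dne em

  basis-indep : IsBasis T C → Ind C
  basis-indep = proj₁ ∘ proj₁

  basis-⊆ : IsBasis T C → C ⊆ T
  basis-⊆ = proj₂ ∘ proj₁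

  indep⊆G : Ind A → A ⊆ G
  indep⊆G = indep⊆ground _

  indep-mono : Ind B → A ⊆ B → Ind A
  indep-mono = I2 _ _

  -- For independent A this says that T lies in the closure of A.
  Spans : Subset E → Subset E → Set
  Spans A T = ∀ y → y ∈ T → Ind (A ∪ ｛ y ｝) → y ∈ A

  isBasis⇒spans : IsBasis T C → Spans C T
  isBasis⇒spans {C = C} ((_ , C⊆T) , maxC) y y∈T indC+y =
    maxC _ (indC+y , ∪｛｝-⊆ C⊆T y∈T) (⊆-∪ˡ C _) y (x∈A∪｛x｝ C)

  spans⇒isBasis : Ind C → C ⊆ T → Spans C T → IsBasis T C
  spans⇒isBasis {C = C} indC C⊆T spans =
    (indC , C⊆T) , λ W (indW , W⊆T) C⊆W u u∈W → spans u (W⊆T u u∈W) (indep-mono indW (∪｛｝-⊆ C⊆W u∈W))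

  extend-to-basis : Ind A → A ⊆ T → T ⊆ G → Σ[ C ∈ Subset E ] IsBasis T C × A ⊆ C
  extend-to-basis {A = A} {T = T} indA A⊆T T⊆G with IM A T indA A⊆T T⊆G
  ... | C , (indC , A⊆C , C⊆T) , maxC =
    C , ((indC , C⊆T) , λ W (indW , W⊆T) C⊆W → maxC W (indW , ⊆-trans A⊆C C⊆W , W⊆T) C⊆W) , A⊆C

  extend-to-base : Ind A → Σ[ B ∈ Subset E ] IsBase N B × A ⊆ B
  extend-to-base indA with extend-to-basis indA (indep⊆G indA) ⊆-refl
  ... | B , basisB , A⊆B = B , isMaximal-⇔ (λ J → proj₁) (λ J indJ → indJ , indep⊆G indJ) basisB , A⊆B

  augment-base : Ind A → ¬ IsBase N A → IsBase N B → ∃[ x ] x ∈ B × x ∉ A × Ind (A ∪ ｛ x ｝)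
  augment-base {A = A} {B = B} indA ¬baseA baseB with I3 A B indA ¬baseA baseB
  ... | x , x∈B , x∉A , J , J≐A+x , indJ =
    x , x∈B , x∉A , indep-mono indJ (∪｛｝-⊆ (λ y y∈A → proj₂ (J≐A+x y) (inj₁ y∈A)) (proj₂ (J≐A+x x) (inj₂ refl)))

  basis-containing-base-isBase : IsBasis T C → IsBase N B → B ⊆ T → IsBase N C
  basis-containing-base-isBase {C = C} basisC baseB B⊆T with em {IsBase N C}
  ... | yes baseC = baseC
  ... | no ¬baseC with augment-base (basis-indep basisC) ¬baseC baseB
  ... | x , x∈B , x∉C , indC+x = ⊥-elim (x∉C (isBasis⇒spans basisC x (B⊆T x x∈B) indC+x))

  base-exchange : IsBase N B → w ∈ B → IsBase N J → w ∉ J →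
                  ∃[ x ] x ∈ J × x ∉ B × Ind ((B ─ ｛ w ｝) ∪ ｛ x ｝)
  base-exchange {B = B} {w = w} {J = J} baseB w∈B baseJ w∉J = exchange (augment-base indB−w ¬baseB−w baseJ)
    where
    indB−w : Ind (B ─ ｛ w ｝)
    indB−w = indep-mono (proj₁ baseB) (─-⊆ B ｛ w ｝)
    ¬baseB−w : ¬ IsBase N (B ─ ｛ w ｝)
    ¬baseB−w (_ , max) = proj₂ (─⁻ B ｛ w ｝ (max B (proj₁ baseB) (─-⊆ B ｛ w ｝) w w∈B)) (∈｛｝⁺ refl)
    exchange : ∃[ x ] x ∈ J × x ∉ B ─ ｛ w ｝ × Ind ((B ─ ｛ w ｝) ∪ ｛ x ｝) →
               ∃[ x ] x ∈ J × x ∉ B × Ind ((B ─ ｛ w ｝) ∪ ｛ x ｝)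
    exchange (x , x∈J , x∉B−w , ind) =
      x , x∈J , (λ x∈B → x∉B−w (─⁺ B ｛ w ｝ x∈B λ x≡w → w∉J (subst (_∈ J) (∈｛｝⁻ x≡w) x∈J))) , ind

  base-─-⊆-basis : IsBasis T C → IsBase N B → C ⊆ B → IsBase N J → J ─ B ⊆ T → B ─ J ⊆ C
  base-─-⊆-basis {C = C} {B = B} {J = J} basisC baseB C⊆B baseJ J─B⊆T w w∈B─J with ∈? C w
  ... | yes w∈C = w∈C
  ... | no w∉C with base-exchange baseB (proj₁ (─⁻ B J w∈B─J)) baseJ (proj₂ (─⁻ B J w∈B─J))
  ... | x , x∈J , x∉B , ind =
    ⊥-elim (x∉B (C⊆B x (isBasis⇒spans basisC x (J─B⊆T x (─⁺ J B x∈J x∉B)) (indep-mono ind C+x⊆))))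
    where
    C+x⊆ : C ∪ ｛ x ｝ ⊆ (B ─ ｛ w ｝) ∪ ｛ x ｝
    C+x⊆ = ∪-monoˡ ｛ x ｝ λ v v∈C → ─⁺ B ｛ w ｝ (C⊆B v v∈C) λ v≡w → w∉C (subst (_∈ C) (∈｛｝⁻ v≡w) v∈C)

  -- Extend C to a base B, then A to a base J₀ ⊆ A ∪ B and A + y to a base J₁ ⊆ J₀ + y.  Since J₁ − B ⊆ T,
  -- base-─-⊆-basis puts B − J₁ inside C, which A spans; so J₀ ⊆ J₁, hence J₁ = J₀ ∋ y and y ∈ A.
  spans-basis⇒spans : IsBasis T C → Ind A → A ⊆ T → Spans A C → Spans A T
  spans-basis⇒spans {T = T} {C = C} {A = A} basisC indA A⊆T A-spans-C y y∈T indA+y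
    with extend-to-base (basis-indep basisC)
  ... | B , baseB , C⊆B
    with extend-to-basis indA (⊆-∪ˡ A B) (∪-⊆ (indep⊆G indA) (indep⊆G (proj₁ baseB)))
  ... | J₀ , basisJ₀ , A⊆J₀
    with extend-to-basis indA+y (∪-monoˡ ｛ y ｝ A⊆J₀)
           (∪｛｝-⊆ (indep⊆G (basis-indep basisJ₀)) (indep⊆G indA+y y (x∈A∪｛x｝ A)))
  ... | J₁ , basisJ₁ , A+y⊆J₁ = y∈A
    where
    J₀⊆A∪B : J₀ ⊆ A ∪ B
    J₀⊆A∪B = basis-⊆ basisJ₀
    baseJ₀ : IsBase N J₀
    baseJ₀ = basis-containing-base-isBase basisJ₀ baseB (⊆-∪ʳ A B)
    baseJ₁ : IsBase N J₁
    baseJ₁ = basis-containing-base-isBase basisJ₁ baseJ₀ (⊆-∪ˡ J₀ ｛ y ｝)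
    J₀∩C⊆A : ∀ x → x ∈ J₀ → x ∈ C → x ∈ A
    J₀∩C⊆A x x∈J₀ x∈C = A-spans-C x x∈C (indep-mono (proj₁ baseJ₀) (∪｛｝-⊆ A⊆J₀ x∈J₀))
    J₁─B⊆T : J₁ ─ B ⊆ T
    J₁─B⊆T x x∈J₁─B with ∪⁻ J₀ ｛ y ｝ (basis-⊆ basisJ₁ x (proj₁ (─⁻ J₁ B x∈J₁─B)))
    ... | inj₂ x≡y = subst (_∈ T) (sym (∈｛｝⁻ x≡y)) y∈T
    ... | inj₁ x∈J₀ with ∪⁻ A B (J₀⊆A∪B x x∈J₀)
    ...   | inj₁ x∈A = A⊆T x x∈A
    ...   | inj₂ x∈B = ⊥-elim (proj₂ (─⁻ J₁ B x∈J₁─B) x∈B)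
    J₀⊆J₁ : J₀ ⊆ J₁
    J₀⊆J₁ w w∈J₀ with ∈? J₁ w
    ... | yes w∈J₁ = w∈J₁
    ... | no w∉J₁ with ∪⁻ A B (J₀⊆A∪B w w∈J₀)
    ...   | inj₁ w∈A = A+y⊆J₁ w (∪⁺ˡ A ｛ y ｝ w∈A)
    ...   | inj₂ w∈B = A+y⊆J₁ w (∪⁺ˡ A ｛ y ｝
                         (J₀∩C⊆A w w∈J₀ (base-─-⊆-basis basisC baseB C⊆B baseJ₁ J₁─B⊆T w (─⁺ B J₁ w∈B w∉J₁))))
    y∈J₀ : y ∈ J₀
    y∈J₀ = proj₂ baseJ₀ J₁ (proj₁ baseJ₁) J₀⊆J₁ y (A+y⊆J₁ y (x∈A∪｛x｝ A))
    y∈A : y ∈ A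
    y∈A with ∪⁻ A B (J₀⊆A∪B y y∈J₀)
    ... | inj₁ y∈A = y∈A
    ... | inj₂ y∈B = J₀∩C⊆A y y∈J₀ (isBasis⇒spans basisC y y∈T (indep-mono (proj₁ baseB) (∪｛｝-⊆ C⊆B y∈B)))

  augment : IsBasis T C → Ind A → A ⊆ T → ¬ Spans A T → ∃[ x ] x ∈ C × x ∉ A × Ind (A ∪ ｛ x ｝)
  augment basisC indA A⊆T ¬spans = dne λ ¬aug → ¬spans (spans-basis⇒spans basisC indA A⊆T
    λ x x∈C indA+x → dne λ x∉A → ¬aug (x , x∈C , x∉A , indA+x))

  isBasis-exchange : IsBasis T C → f ∈ T → f ∉ C → Ind ((C ─ ｛ z ｝) ∪ ｛ f ｝) →
                     IsBasis T ((C ─ ｛ z ｝) ∪ ｛ f ｝)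
  isBasis-exchange {T = T} {C = C} {f = f} {z = z} basisC f∈T f∉C indC′ =
    spans⇒isBasis indC′ C′⊆T (spans-basis⇒spans basisC indC′ C′⊆T C′-spans-C)
    where
    C′ : Subset E
    C′ = (C ─ ｛ z ｝) ∪ ｛ f ｝
    C′⊆T : C′ ⊆ T
    C′⊆T = ∪｛｝-⊆ (⊆-trans (─-⊆ C ｛ z ｝) (basis-⊆ basisC)) f∈T
    C′-spans-C : Spans C′ C
    C′-spans-C x x∈C indC′+x with ∈? ｛ z ｝ x
    ... | no x∉｛z｝ = ∪⁺ˡ (C ─ ｛ z ｝) ｛ f ｝ (─⁺ C ｛ z ｝ x∈C x∉｛z｝)
    ... | yes x∈｛z｝ with ∈｛｝⁻ x∈｛z｝
    ...   | refl = ⊥-elim (f∉C (isBasis⇒spans basisC f f∈T (indep-mono indC′+x C+f⊆C′+z)))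
      where
      C+f⊆C′+z : C ∪ ｛ f ｝ ⊆ C′ ∪ ｛ z ｝
      C+f⊆C′+z = ∪｛｝-⊆ (⊆-trans (⊆-─-∪ C ｛ z ｝) (∪-monoˡ ｛ z ｝ (⊆-∪ˡ (C ─ ｛ z ｝) ｛ f ｝)))
                         (∪⁺ˡ C′ ｛ z ｝ (x∈A∪｛x｝ (C ─ ｛ z ｝)))

  basis-exchange : IsBasis T C₁ → IsBasis T C₂ → z ∈ C₁ → z ∉ C₂ →
                   ∃[ f ] f ∈ C₂ × f ∉ C₁ × IsBasis T ((C₁ ─ ｛ z ｝) ∪ ｛ f ｝)
  basis-exchange {T = T} {C₁ = C₁} {C₂ = C₂} {z = z} basis₁ basis₂ z∈C₁ z∉C₂ =
    exchange (augment basis₂ indC₁−z (⊆-trans (─-⊆ C₁ ｛ z ｝) C₁⊆T) ¬spans)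
    where
    C₁⊆T : C₁ ⊆ T
    C₁⊆T = basis-⊆ basis₁
    indC₁−z : Ind (C₁ ─ ｛ z ｝)
    indC₁−z = indep-mono (basis-indep basis₁) (─-⊆ C₁ ｛ z ｝)
    ¬spans : ¬ Spans (C₁ ─ ｛ z ｝) T
    ¬spans spans = proj₂ (─⁻ C₁ ｛ z ｝ (spans z (C₁⊆T z z∈C₁)
                     (indep-mono (basis-indep basis₁) (∪｛｝-⊆ (─-⊆ C₁ ｛ z ｝) z∈C₁)))) (∈｛｝⁺ refl)
    exchange : ∃[ f ] f ∈ C₂ × f ∉ C₁ ─ ｛ z ｝ × Ind ((C₁ ─ ｛ z ｝) ∪ ｛ f ｝) →
               ∃[ f ] f ∈ C₂ × f ∉ C₁ × IsBasis T ((C₁ ─ ｛ z ｝) ∪ ｛ f ｝)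
    exchange (f , f∈C₂ , f∉C₁−z , ind) = f , f∈C₂ , f∉C₁ , isBasis-exchange basis₁ (basis-⊆ basis₂ f f∈C₂) f∉C₁ ind
      where
      f∉C₁ : f ∉ C₁
      f∉C₁ f∈C₁ = f∉C₁−z (─⁺ C₁ ｛ z ｝ f∈C₁ λ f∈｛z｝ → z∉C₂ (subst (_∈ C₂) (∈｛｝⁻ f∈｛z｝) f∈C₂))

  isBasis-widen : IsBasis T′ C → T′ ⊆ T → IsBasis T C₀ → C₀ ⊆ T′ → IsBasis T C
  isBasis-widen {T′ = T′} {C = C} {T = T} basisC T′⊆T basisC₀ C₀⊆T′ =
    spans⇒isBasis (basis-indep basisC) C⊆T
      (spans-basis⇒spans basisC₀ (basis-indep basisC) C⊆T λ x x∈C₀ → isBasis⇒spans basisC x (C₀⊆T′ x x∈C₀))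
    where
    C⊆T : C ⊆ T
    C⊆T = ⊆-trans (basis-⊆ basisC) T′⊆T

  isBasis-≐ : T ≐ T′ → IsBasis T C → IsBasis T′ C
  isBasis-≐ (T⊆T′ , T′⊆T) =
    isMaximal-⇔ (λ J (indJ , J⊆T) → indJ , ⊆-trans J⊆T T⊆T′) (λ J (indJ , J⊆T′) → indJ , ⊆-trans J⊆T′ T′⊆T)

  isBasis-shrink : IsBasis T C → C ⊆ T′ → T′ ⊆ T → IsBasis T′ C
  isBasis-shrink ((indC , _) , maxC) C⊆T′ T′⊆T =
    (indC , C⊆T′) , λ J (indJ , J⊆T′) → maxC J (indJ , ⊆-trans J⊆T′ T′⊆T)

  complement-hasSize : IsBasis T C₁ → IsBasis T C₂ → C₁ ─ C₂ ⊆ U → C₂ ─ C₁ ⊆ U →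
                       HasSize (U ─ C₂) n → HasSize (U ─ C₁) n
  complement-hasSize {C₁ = C₁} {C₂ = C₂} basis₁ basis₂ C₁─C₂⊆U C₂─C₁⊆U φ with em {∃[ z ] z ∈ C₁ × z ∉ C₂}
  complement-hasSize {C₁ = C₁} {C₂ = C₂} {U = U} basis₁ basis₂ C₁─C₂⊆U C₂─C₁⊆U φ | no ¬z =
    hasSize-≐ (─-antimonoʳ U C₁⊆C₂ , ─-antimonoʳ U C₂⊆C₁) φ
    where
    C₁⊆C₂ : C₁ ⊆ C₂
    C₁⊆C₂ x x∈C₁ = dne λ x∉C₂ → ¬z (x , x∈C₁ , x∉C₂)
    C₂⊆C₁ : C₂ ⊆ C₁
    C₂⊆C₁ = proj₂ basis₁ C₂ (proj₁ basis₂) C₁⊆C₂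
  complement-hasSize {C₁ = C₁} {C₂ = C₂} {U = U} {n = zero} _ _ C₁─C₂⊆U _ φ | yes (z , z∈C₁ , z∉C₂) =
    ⊥-elim (hasSize-zero⇒∉ φ (─⁺ U C₂ (C₁─C₂⊆U z (─⁺ C₁ C₂ z∈C₁ z∉C₂)) z∉C₂))
  complement-hasSize {T = T} {C₁ = C₁} {C₂ = C₂} {U = U} {n = suc m} basis₁ basis₂ C₁─C₂⊆U C₂─C₁⊆U φ
    | yes (z , z∈C₁ , z∉C₂) = exchange (basis-exchange basis₁ basis₂ z∈C₁ z∉C₂)
    where
    -- A continuation rather than a with: abstracting over a goal that mentions HasSize
    -- makes Agda normalise the Inverse record behind it, which is prohibitively slow.
    exchange : ∃[ f ] f ∈ C₂ × f ∉ C₁ × IsBasis T ((C₁ ─ ｛ z ｝) ∪ ｛ f ｝) → HasSize (U ─ C₁) (suc m)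
    exchange (f , f∈C₂ , f∉C₁ , basis₁′) =
      hasSize-insert {A = U ─ C₁} (─⁺ U C₁ (C₂─C₁⊆U f (─⁺ C₂ C₁ f∈C₂ f∉C₁)) f∉C₁) U─C₁−f-size
      where
      C₁′ : Subset E
      C₁′ = (C₁ ─ ｛ z ｝) ∪ ｛ f ｝
      U−z─C₂-size : HasSize ((U ─ ｛ z ｝) ─ C₂) m
      U−z─C₂-size = hasSize-≐ {A = (U ─ C₂) ─ ｛ z ｝} (─-comm U C₂ ｛ z ｝ , ─-comm U ｛ z ｝ C₂)
                      (hasSize-remove {A = U ─ C₂} (─⁺ U C₂ (C₁─C₂⊆U z (─⁺ C₁ C₂ z∈C₁ z∉C₂)) z∉C₂) φ)
      U−z─C₁′-size : HasSize ((U ─ ｛ z ｝) ─ C₁′) m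
      U−z─C₁′-size = complement-hasSize {C₁ = C₁′} {C₂ = C₂} {U = U ─ ｛ z ｝} basis₁′ basis₂
                       (─-exchange-⊆ˡ {C₁ = C₁} f∈C₂ C₁─C₂⊆U) (─-exchange-⊆ʳ {C₂ = C₂} {f = f} z∉C₂ C₂─C₁⊆U)
                       U−z─C₂-size
      U─C₁−f-size : HasSize ((U ─ C₁) ─ ｛ f ｝) m
      U─C₁−f-size = hasSize-≐ {A = (U ─ ｛ z ｝) ─ C₁′} (─-exchange-≐ U C₁ z∈C₁) U−z─C₁′-size

  complement-sameSize : IsBasis T C₁ → IsBasis T C₂ → SameSizeℕ∞ (T ─ C₁) (T ─ C₂)
  complement-sameSize basis₁ basis₂ n =
    complement-hasSize basis₂ basis₁ (⊆-trans (─-⊆ _ _) (basis-⊆ basis₂)) (⊆-trans (─-⊆ _ _) (basis-⊆ basis₁)) ,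
    complement-hasSize basis₁ basis₂ (⊆-trans (─-⊆ _ _) (basis-⊆ basis₁)) (⊆-trans (─-⊆ _ _) (basis-⊆ basis₂))

  isBasis-∪ : IsBasis Y P → IsBasis (P ∪ Z) Q → P ⊆ Q → IsBasis (Y ∪ Z) Q
  isBasis-∪ {Y = Y} {P = P} {Z = Z} {Q = Q} basisP basisQ P⊆Q =
    spans⇒isBasis indQ (⊆-trans (basis-⊆ basisQ) (∪-monoˡ Z (basis-⊆ basisP))) Q-spans
    where
    indQ : Ind Q
    indQ = basis-indep basisQ
    Q-spans : Spans Q (Y ∪ Z)
    Q-spans u u∈Y∪Z indQ+u with ∪⁻ Y Z u∈Y∪Z
    ... | inj₁ u∈Y = P⊆Q u (isBasis⇒spans basisP u u∈Y (indep-mono indQ+u (∪-monoˡ ｛ u ｝ P⊆Q)))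
    ... | inj₂ u∈Z = isBasis⇒spans basisQ u (∪⁺ʳ P Z u∈Z) indQ+u

  indep-∪-basis-swap : IsBasis Y P₁ → IsBasis Y P₂ → Disjoint Z Y → Ind (P₁ ∪ Z) → Ind (P₂ ∪ Z)
  indep-∪-basis-swap {Y = Y} {P₁ = P₁} {P₂ = P₂} {Z = Z} basis₁ basis₂ Z∩Y=∅ indP₁∪Z
    with extend-to-basis (basis-indep basis₂) (⊆-∪ˡ P₂ Z)
           (∪-⊆ (indep⊆G (basis-indep basis₂)) (⊆-trans (⊆-∪ʳ P₁ Z) (indep⊆G indP₁∪Z)))
  ... | Q , basisQ , P₂⊆Q = indep-mono (basis-indep basisQ) (∪-⊆ P₂⊆Q Z⊆Q)
    where
    P₁⊆Y : P₁ ⊆ Y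
    P₁⊆Y = basis-⊆ basis₁
    A₀ : Subset E
    A₀ = P₁ ∪ (Q ∩ Z)
    A₀⊆P₁∪Z : A₀ ⊆ P₁ ∪ Z
    A₀⊆P₁∪Z = ∪-monoʳ P₁ (∩-⊆ʳ Q Z)
    A₀-spans-Q : Spans A₀ Q
    A₀-spans-Q x x∈Q indA₀+x with ∪⁻ P₂ Z (basis-⊆ basisQ x x∈Q)
    ... | inj₂ x∈Z = ∪⁺ʳ P₁ (Q ∩ Z) (∩⁺ Q Z x∈Q x∈Z)
    ... | inj₁ x∈P₂ = ∪⁺ˡ P₁ (Q ∩ Z) (isBasis⇒spans basis₁ x (basis-⊆ basis₂ x x∈P₂)
                                        (indep-mono indA₀+x (∪-monoˡ ｛ x ｝ (⊆-∪ˡ P₁ (Q ∩ Z)))))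
    A₀-spans : Spans A₀ (Y ∪ Z)
    A₀-spans = spans-basis⇒spans (isBasis-∪ basis₂ basisQ P₂⊆Q) (indep-mono indP₁∪Z A₀⊆P₁∪Z)
                 (⊆-trans A₀⊆P₁∪Z (∪-monoˡ Z P₁⊆Y)) A₀-spans-Q
    Z⊆Q : Z ⊆ Q
    Z⊆Q z z∈Z with ∪⁻ P₁ (Q ∩ Z) (A₀-spans z (∪⁺ʳ Y Z z∈Z) (indep-mono indP₁∪Z (∪｛｝-⊆ A₀⊆P₁∪Z (∪⁺ʳ P₁ Z z∈Z))))
    ... | inj₁ z∈P₁  = ⊥-elim (Z∩Y=∅ z z∈Z (P₁⊆Y z z∈P₁))
    ... | inj₂ z∈Q∩Z = proj₁ (∩⁻ Q Z z∈Q∩Z)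

  basis-swap : IsBasis Y P₁ → IsBasis Y P₂ → Disjoint W Y → IsBasis (P₁ ∪ W) C → P₁ ⊆ C →
               IsBasis (P₂ ∪ W) (P₂ ∪ (C ─ Y))
  basis-swap {Y = Y} {P₁ = P₁} {P₂ = P₂} {W = W} {C = C} basis₁ basis₂ W∩Y=∅ basisC P₁⊆C =
    spans⇒isBasis indP₂∪Z₀ (∪-monoʳ P₂ Z₀⊆W) P₂∪Z₀-spans
    where
    Z₀ : Subset E
    Z₀ = C ─ Y
    C⊆P₁∪W : C ⊆ P₁ ∪ W
    C⊆P₁∪W = basis-⊆ basisC
    Z₀⊆W : Z₀ ⊆ W
    Z₀⊆W x x∈Z₀ with ─⁻ C Y x∈Z₀
    ... | x∈C , x∉Y = [ (λ x∈P₁ → ⊥-elim (x∉Y (basis-⊆ basis₁ x x∈P₁))) , (λ x∈W → x∈W) ]′ (∪⁻ P₁ W (C⊆P₁∪W x x∈C))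
    C⊆P₁∪Z₀ : C ⊆ P₁ ∪ Z₀
    C⊆P₁∪Z₀ x x∈C with ∈? Y x
    ... | no x∉Y = ∪⁺ʳ P₁ Z₀ (─⁺ C Y x∈C x∉Y)
    ... | yes x∈Y = [ ∪⁺ˡ P₁ Z₀ , (λ x∈W → ⊥-elim (W∩Y=∅ x x∈W x∈Y)) ]′ (∪⁻ P₁ W (C⊆P₁∪W x x∈C))
    indP₂∪Z₀ : Ind (P₂ ∪ Z₀)
    indP₂∪Z₀ = indep-∪-basis-swap basis₁ basis₂ (λ x x∈Z₀ → proj₂ (─⁻ C Y x∈Z₀))
                (indep-mono (basis-indep basisC) (∪-⊆ P₁⊆C (─-⊆ C Y)))
    P₂∪Z₀-spans : Spans (P₂ ∪ Z₀) (P₂ ∪ W)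
    P₂∪Z₀-spans u u∈P₂∪W ind+u with ∪⁻ P₂ W u∈P₂∪W
    ... | inj₁ u∈P₂ = ∪⁺ˡ P₂ Z₀ u∈P₂
    ... | inj₂ u∈W = ∪⁺ʳ P₂ Z₀ (─⁺ C Y u∈C (W∩Y=∅ u u∈W))
      where
      Z₀+u∩Y=∅ : Disjoint (Z₀ ∪ ｛ u ｝) Y
      Z₀+u∩Y=∅ x x∈Z₀+u =
        [ (λ x∈Z₀ → proj₂ (─⁻ C Y x∈Z₀)) , (λ x∈｛u｝ → subst (_∉ Y) (sym (∈｛｝⁻ x∈｛u｝)) (W∩Y=∅ u u∈W)) ]′
          (∪⁻ Z₀ ｛ u ｝ x∈Z₀+u)
      indP₁∪Z₀+u : Ind (P₁ ∪ (Z₀ ∪ ｛ u ｝))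
      indP₁∪Z₀+u = indep-∪-basis-swap basis₂ basis₁ Z₀+u∩Y=∅ (indep-mono ind+u (proj₁ (∪-assoc P₂ Z₀ ｛ u ｝)))
      u∈C : u ∈ C
      u∈C = isBasis⇒spans basisC u (∪⁺ʳ P₁ W u∈W) (indep-mono indP₁∪Z₀+u
              (∪｛｝-⊆ (⊆-trans C⊆P₁∪Z₀ (∪-monoʳ P₁ (⊆-∪ˡ Z₀ ｛ u ｝))) (∪⁺ʳ P₁ (Z₀ ∪ ｛ u ｝) (x∈A∪｛x｝ Z₀))))

  SameNullity : Subset E → Subset E → Set
  SameNullity T T′ = ∀ {C C′} → IsBasis T C → IsBasis T′ C′ → SameSizeℕ∞ (T ─ C) (T′ ─ C′)

  sameNullity-trans : T′ ⊆ G → SameNullity T T′ → SameNullity T′ T″ → SameNullity T T″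
  sameNullity-trans T′⊆G T~T′ T′~T″ basisC basisC″ =
    let (C′ , basisC′ , _) = extend-to-basis I1 (λ x ()) T′⊆G
    in sameSize-trans (T~T′ basisC basisC′) (T′~T″ basisC′ basisC″)

  sameNullity-≐ : T ≐ T′ → SameNullity T T′
  sameNullity-≐ {T = T} {T′ = T′} T≐T′ {C = C} basisC basisC′ =
    sameSize-trans (sameSize-≐ (─-monoˡ C (proj₁ T≐T′) , ─-monoˡ C (proj₂ T≐T′)))
                   (complement-sameSize (isBasis-≐ T≐T′ basisC) basisC′)

  sameNullity-swap : IsBasis Y P₁ → IsBasis Y P₂ → Disjoint W Y → W ⊆ G → SameNullity (P₁ ∪ W) (P₂ ∪ W)
  sameNullity-swap {P₁ = P₁} {W = W} basis₁ basis₂ W∩Y=∅ W⊆G basisC₁ basisC₂ =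
    let (C , basisC , P₁⊆C) =
          extend-to-basis (basis-indep basis₁) (⊆-∪ˡ P₁ W) (∪-⊆ (indep⊆G (basis-indep basis₁)) W⊆G)
    in sameSize-trans (complement-sameSize basisC₁ basisC)
         (sameSize-trans (sameSize-≐ (swap-─ W∩Y=∅ P₁⊆C (basis-⊆ basis₂)))
           (complement-sameSize (basis-swap basis₁ basis₂ W∩Y=∅ basisC P₁⊆C) basisC₂))

  open DualBases N indep⊆ground

  indep-dual-dual⇒ : Indep (dual (dual N)) A → Ind A
  indep-dual-dual⇒ {A = A} (A⊆G , B₀ , baseB₀ , B₀⊆G─A) with isBase-dual⇒complement baseB₀
  ... | B , baseB , B₀≐G─B = indep-mono (proj₁ baseB) A⊆B
    where
    A⊆B : A ⊆ B
    A⊆B x x∈A with ∈? B x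
    ... | yes x∈B = x∈B
    ... | no x∉B = ⊥-elim (proj₂ (─⁻ G A (B₀⊆G─A x (proj₂ B₀≐G─B x (─⁺ G B (A⊆G x x∈A) x∉B)))) x∈A)

  indep-dual-dual⇐ : Ind A → Indep (dual (dual N)) A
  indep-dual-dual⇐ {A = A} indA with extend-to-base indA
  ... | B , baseB , A⊆B = indep⊆G indA , G ─ B , complement-isBase-dual baseB , ─-antimonoʳ G A⊆B

  isBase-delete-dual-dual⇒ : IsBase (delete (dual (dual N)) Z) D → IsBasis (G ─ Z) D
  isBase-delete-dual-dual⇒ =
    isMaximal-⇔ (λ J (indJ , J⊆) → indep-dual-dual⇒ indJ , J⊆) (λ J (indJ , J⊆) → indep-dual-dual⇐ indJ , J⊆)

  isBase-delete-dual-dual⇐ : IsBasis (G ─ Z) D → IsBase (delete (dual (dual N)) Z) D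
  isBase-delete-dual-dual⇐ =
    isMaximal-⇔ (λ J (indJ , J⊆) → indep-dual-dual⇐ indJ , J⊆) (λ J (indJ , J⊆) → indep-dual-dual⇒ indJ , J⊆)

  maximally-avoiding-basis-restricts : Disjoint A Y → A ∪ Y ⊆ G → IsBasis (A ∪ Y) D →
    (∀ D′ → IsBasis (A ∪ Y) D′ → A ─ D ⊆ A ─ D′ → A ─ D′ ⊆ A ─ D) → IsBasis Y (D ∩ Y)
  maximally-avoiding-basis-restricts {A = A} {Y = Y} {D = D} A∩Y=∅ A∪Y⊆G basisD maximal =
    spans⇒isBasis (indep-mono (basis-indep basisD) (∩-⊆ˡ D Y)) (∩-⊆ʳ D Y) D∩Y-spans
    where
    D⊆A∪Y : D ⊆ A ∪ Y
    D⊆A∪Y = basis-⊆ basisD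
    D∩Y-spans : Spans (D ∩ Y) Y
    D∩Y-spans u u∈Y ind
      with extend-to-basis ind (∪-monoˡ ｛ u ｝ (∩-⊆ˡ D Y)) (∪｛｝-⊆ (⊆-trans D⊆A∪Y A∪Y⊆G) (A∪Y⊆G u (∪⁺ʳ A Y u∈Y)))
    ... | D₃ , basisD₃ , D∩Y+u⊆D₃ = ∩⁺ D Y (D₃⊆D u (D∩Y+u⊆D₃ u (x∈A∪｛x｝ (D ∩ Y)))) u∈Y
      where
      basisD₃′ : IsBasis (A ∪ Y) D₃
      basisD₃′ = isBasis-widen basisD₃ (∪｛｝-⊆ D⊆A∪Y (∪⁺ʳ A Y u∈Y)) basisD (⊆-∪ˡ D ｛ u ｝)
      A─D⊆A─D₃ : A ─ D ⊆ A ─ D₃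
      A─D⊆A─D₃ x p with ─⁻ A D p
      ... | x∈A , x∉D = ─⁺ A D₃ x∈A λ x∈D₃ →
        [ x∉D , (λ x∈｛u｝ → A∩Y=∅ x x∈A (subst (_∈ Y) (sym (∈｛｝⁻ x∈｛u｝)) u∈Y)) ]′
          (∪⁻ D ｛ u ｝ (basis-⊆ basisD₃ x x∈D₃))
      D⊆D₃ : D ⊆ D₃
      D⊆D₃ v v∈D with ∈? D₃ v
      ... | yes v∈D₃ = v∈D₃
      ... | no v∉D₃ with ∪⁻ A Y (D⊆A∪Y v v∈D)
      ...   | inj₂ v∈Y = D∩Y+u⊆D₃ v (∪⁺ˡ (D ∩ Y) ｛ u ｝ (∩⁺ D Y v∈D v∈Y))
      ...   | inj₁ v∈A = ⊥-elim (proj₂ (─⁻ A D (maximal D₃ basisD₃′ A─D⊆A─D₃ v (─⁺ A D₃ v∈A v∉D₃))) v∈D)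
      D₃⊆D : D₃ ⊆ D
      D₃⊆D = proj₂ basisD D₃ (proj₁ basisD₃′) D⊆D₃

  isBasis-∪-trim : IsBasis (A ∪ Y) D → IsBasis ((D ∩ Y) ∪ A) D × A ─ D ≐ ((D ∩ Y) ∪ A) ─ D
  isBasis-∪-trim {A = A} {Y = Y} {D = D} basisD =
    isBasis-shrink basisD D⊆D∩Y∪A (∪-⊆ (⊆-trans (∩-⊆ʳ D Y) (⊆-∪ʳ A Y)) (⊆-∪ˡ A Y)) ,
    ─-monoˡ D (⊆-∪ʳ (D ∩ Y) A) , D∩Y∪A─D⊆A─D
    where
    D⊆D∩Y∪A : D ⊆ (D ∩ Y) ∪ A
    D⊆D∩Y∪A x x∈D = [ ∪⁺ʳ (D ∩ Y) A , (λ x∈Y → ∪⁺ˡ (D ∩ Y) A (∩⁺ D Y x∈D x∈Y)) ]′ (∪⁻ A Y (basis-⊆ basisD x x∈D))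
    D∩Y∪A─D⊆A─D : ((D ∩ Y) ∪ A) ─ D ⊆ A ─ D
    D∩Y∪A─D⊆A─D x p =
      let (x∈D∩Y∪A , x∉D) = ─⁻ ((D ∩ Y) ∪ A) D p
      in ─⁺ A D ([ (λ x∈D∩Y → ⊥-elim (x∉D (proj₁ (∩⁻ D Y x∈D∩Y)))) , (λ x∈A → x∈A) ]′ (∪⁻ (D ∩ Y) A x∈D∩Y∪A)) x∉D

  connectivity-as-nullity : T ⊆ G → IsBase (dual (restrict N T)) J →
                            Σ[ C ∈ Subset E ] IsBasis T C × SameSizeℕ∞ J (T ─ C)
  connectivity-as-nullity {T = T} {J = J} T⊆G baseJ =
    let (C , basisC , J⊆G∩T─C , G∩T─C⊆J) =
          DualBases.isBase-dual⇒complement (restrict N T) (restrict-indep⊆ground indep⊆ground) baseJ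
    in C , basisC , sameSize-≐ {A = J} {B = T ─ C}
                      ( ⊆-trans J⊆G∩T─C (─-monoˡ C (∩-⊆ʳ G T))
                      , ⊆-trans (─-monoˡ C λ x p → ∩⁺ G T (T⊆G x p) p) G∩T─C⊆J)

  relativeRank-as-nullity : X ⊆ G → IsBasis X I → IsBasisOf (contract (dual N) (X ─ I)) I K →
    Σ[ B″ ∈ Subset E ] Σ[ D ∈ Subset E ] IsBasis (G ─ X) B″ × IsBasis (B″ ∪ I) D × SameSizeℕ∞ K ((B″ ∪ I) ─ D)
  relativeRank-as-nullity {X = X} {I = I} {K = K} X⊆G basisI basisK =
    let (D , baseD , K≐I─D , maximal) =
          DualBases.isBasisOf-dual⇒complement (delete (dual (dual N)) (X ─ I))
            (restrict-indep⊆ground (λ A → proj₁)) I⊆S basisK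
        basisD : IsBasis (I ∪ (G ─ X)) D
        basisD = isBasis-≐ S≐ (isBase-delete-dual-dual⇒ baseD)
        (basisD′ , I─D≐) = isBasis-∪-trim basisD
    in D ∩ (G ─ X) , D ,
       maximally-avoiding-basis-restricts I∩G─X=∅ (∪-⊆ I⊆G (─-⊆ G X)) basisD
         (λ D′ basisD′ → maximal D′ (isBase-delete-dual-dual⇐ (isBasis-≐ (≐-sym S≐) basisD′))) ,
       basisD′ , sameSize-≐ {A = K} (≐-trans K≐I─D I─D≐)
    where
    I⊆X : I ⊆ X
    I⊆X = basis-⊆ basisI
    I⊆G : I ⊆ G
    I⊆G = ⊆-trans I⊆X X⊆G
    I∩G─X=∅ : Disjoint I (G ─ X)
    I∩G─X=∅ x x∈I x∈G─X = proj₂ (─⁻ G X x∈G─X) (I⊆X x x∈I)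
    S≐ : G ─ (X ─ I) ≐ I ∪ (G ─ X)
    S≐ = ─-─ G X I I⊆X X⊆G
    I⊆S : I ⊆ G ∩ (G ─ (X ─ I))
    I⊆S x x∈I = ∩⁺ G (G ─ (X ─ I)) (I⊆G x x∈I) (proj₂ S≐ x (∪⁺ˡ I (G ─ X) x∈I))

mainTheorem10 : ExcludedMiddle 0ℓ →
    {E : Set} (M : Matroid E) (X I : Subset E) →
    X ⊆ ground (system M) →
    IsBasisOf (system M) X I →
    (B B' J K : Subset E) →
    IsBasisOf (system M) X B →
    IsBasisOf (system M) (ground (system M) ─ X) B' →
    IsBase (dual (restrict (system M) (B ∪ B'))) J →
    IsBasisOf (contract (dual (system M)) (X ─ I)) I K →
    SameSizeℕ∞ J K
mainTheorem10 em M X I X⊆G basisI B B′ J K basisB basisB′ baseJ basisK =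
  let (C , basisC , J~B∪B′─C) = connectivity-as-nullity (∪-⊆ (⊆-trans (basis-⊆ basisB) X⊆G) B′⊆G) baseJ
      (B″ , D , basisB″ , basisD , K~B″∪I─D) = relativeRank-as-nullity X⊆G basisI basisK
      nullity : SameNullity (B ∪ B′) (B″ ∪ I)
      nullity = sameNullity-trans (∪-⊆ I⊆G B′⊆G) (sameNullity-swap basisB basisI B′∩X=∅ B′⊆G)
                  (sameNullity-trans (∪-⊆ B′⊆G I⊆G) (sameNullity-≐ (∪-comm I B′))
                    (sameNullity-swap basisB′ basisB″ I∩G─X=∅ I⊆G))
  in sameSize-trans {A = J} J~B∪B′─C (sameSize-trans (nullity basisC basisD) (sameSize-sym {A = K} K~B″∪I─D))
  where
  open MatroidTheory em M
  I⊆G : I ⊆ G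
  I⊆G = ⊆-trans (basis-⊆ basisI) X⊆G
  B′⊆G : B′ ⊆ G
  B′⊆G = ⊆-trans (basis-⊆ basisB′) (─-⊆ G X)
  B′∩X=∅ : Disjoint B′ X
  B′∩X=∅ x x∈B′ = proj₂ (─⁻ G X (basis-⊆ basisB′ x x∈B′))
  I∩G─X=∅ : Disjoint I (G ─ X)
  I∩G─X=∅ x x∈I x∈G─X = proj₂ (─⁻ G X x∈G─X) (basis-⊆ basisI x x∈I)
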